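{- Let $G$ be a bipartite graph. There exists an optimal biclustering $\mathcal{B}$ of $G$ such that for every vertex $v\in V(G)$, either exactly $\deg_G(v)$ edges of $E(G)\triangle E(\mathcal{B})$ contain $v$ and all of them are deletions (i.e. belong to $E(G)\setminus E(\mathcal{B})$), or at most $\deg_G(v)-1$ edges of $E(G)\triangle E(\mathcal{B})$ contain $v$.
   Context: Let $G=(V_1\cup V_2,E)$ be bipartite with fixed bipartition. A bicluster is a set $X\cup Y$ with $X\subseteq V_1$, $Y\subseteq V_2$ such that $N(x)=Y$ for all $x\in X$ and $N(y)=X$ for all $y\in Y$ (an isolated vertex is a bicluster). A biclustering of $G$ is a graph $\mathcal{B}$ on vertex set $V(G)$, all of whose edges go between $V_1$ and $V_2$, each of whose connected components is a bicluster; its cost is $|E(G)\triangle E(\mathcal{B})|$, and it is optimal if no biclustering of $G$ has strictly smaller cost. Edges of $E(G)\setminus E(\mathcal{B})$ are deletions and edges of $E(\mathcal{B})\setminus E(G)$ are insertions. -}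

module Defs where

open import Data.Nat using (ℕ; zero; suc; _+_; _<_)
open import Data.Fin using (Fin; zero; suc)
open import Data.Bool using (Bool; true; false; _xor_)
open import Data.Sum using (_⊎_; inj₁; inj₂)
open import Data.Product using (_×_)
open import Relation.Binary.PropositionalEquality using (_≡_)
open import Relation.Binary.Construct.Closure.ReflexiveTransitive using (Star)
open import Function.Bundles using (_⇔_)

-- A bipartite graph with fixed bipartition V₁ = Fin m, V₂ = Fin n,
-- given by its (bi)adjacency matrix: x ∈ V₁ is adjacent to y ∈ V₂ iff G x y ≡ true.
-- Any graph on V₁ ∪ V₂ all of whose edges go between V₁ and V₂ is of this form.
BipGraph : ℕ → ℕ → Set
BipGraph m n = Fin m → Fin n → Bool

Vertex : ℕ → ℕ → Set
Vertex m n = Fin m ⊎ Fin n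

data Adj {m n : ℕ} (B : BipGraph m n) : Vertex m n → Vertex m n → Set where
  left  : ∀ {x y} → B x y ≡ true → Adj B (inj₁ x) (inj₂ y)
  right : ∀ {x y} → B x y ≡ true → Adj B (inj₂ y) (inj₁ x)

Connected : ∀ {m n} → BipGraph m n → Vertex m n → Vertex m n → Set
Connected B = Star (Adj B)

-- Every connected component of B is a bicluster: for the component C of any
-- vertex v, with X = C ∩ V₁ and Y = C ∩ V₂, we have N(x) = Y for x ∈ X and
-- N(y) = X for y ∈ Y (neighbourhoods taken in B).
IsBiclustering : ∀ {m n} → BipGraph m n → Set
IsBiclustering {m} {n} B =
  (v : Vertex m n) →
    ((x : Fin m) → Connected B v (inj₁ x) →
       (y : Fin n) → (B x y ≡ true) ⇔ Connected B v (inj₂ y))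
  × ((y : Fin n) → Connected B v (inj₂ y) →
       (x : Fin m) → (B x y ≡ true) ⇔ Connected B v (inj₁ x))

count : ∀ {k} → (Fin k → Bool) → ℕ
count {zero}  f = 0
count {suc k} f = (if f zero then 1 else 0) + count (λ i → f (suc i))
  where open import Data.Bool using (if_then_else_)

sumFin : ∀ {k} → (Fin k → ℕ) → ℕ
sumFin {zero}  f = 0
sumFin {suc k} f = f zero + sumFin (λ i → f (suc i))

symDiff : ∀ {m n} → BipGraph m n → BipGraph m n → BipGraph m n
symDiff G B x y = G x y xor B x y

cost : ∀ {m n} → BipGraph m n → BipGraph m n → ℕ
cost G B = sumFin (λ x → count (λ y → symDiff G B x y))

IsOptimalBiclustering : ∀ {m n} → BipGraph m n → BipGraph m n → Set
IsOptimalBiclustering {m} {n} G B =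
  IsBiclustering B × ((B' : BipGraph m n) → IsBiclustering B' → cost G B Data.Nat.≤ cost G B')
  where import Data.Nat


deg : ∀ {m n} → BipGraph m n → Vertex m n → ℕ
deg G (inj₁ x) = count (λ y → G x y)
deg G (inj₂ y) = count (λ x → G x y)

diffDeg : ∀ {m n} → BipGraph m n → BipGraph m n → Vertex m n → ℕ
diffDeg G B v = deg (symDiff G B) v

AllDeletionsAt : ∀ {m n} → BipGraph m n → BipGraph m n → Vertex m n → Set
AllDeletionsAt {m} {n} G B (inj₁ x) =
  (y : Fin n) → symDiff G B x y ≡ true → (G x y ≡ true × B x y ≡ false)
AllDeletionsAt {m} {n} G B (inj₂ y) =
  (x : Fin m) → symDiff G B x y ≡ true → (G x y ≡ true × B x y ≡ false)

-- Among the optimal biclusterings of G choose one, B, with the fewest edges. Isolating a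
-- vertex v of B yields again a biclustering, and its cost exceeds that of B by
-- deg v minus the number of edits at v; so optimality bounds the edits at v by deg v. In
-- the case of equality the isolated biclustering is optimal too, so by edge-minimality v
-- has no edge in B, i.e. every edit at v is a deletion. Optimal biclusterings exist because
-- biclusterings are exactly the P₄-free graphs, a decidable class that can be searched
-- exhaustively; vertices of V₂ are handled by transposing G and B.
module Submission where

open import Defs
open import Data.Nat using (ℕ; _≤_; _<_)
open import Data.Sum using (_⊎_)
open import Data.Product using (Σ; _×_)
open import Relation.Binary.PropositionalEquality using (_≡_)

open import Data.Nat.Properties
  using (≤-trans; ≤-reflexive; module ≤-Reasoning; +-assoc; +-identityʳ; +-monoˡ-≤;
         +-cancelˡ-≤; +-cancelʳ-≡; m+n≡0⇒n≡0; n≤0⇒n≡0; m≤n⇒m<n∨m≡n;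
         +-commutativeSemigroup; +-0-commutativeMonoid)
open import Algebra.Properties.CommutativeMonoid.Sum +-0-commutativeMonoid
  using (sum; sum-cong-≗; ∑-comm)
open import Algebra.Properties.CommutativeSemigroup +-commutativeSemigroup using (xy∙z≈zy∙x)
open import Data.Bool using (Bool; true; false; _xor_; if_then_else_)
open import Data.Bool.Properties as Bool using (xor-identityʳ)
open import Data.Fin using (Fin; zero; suc)
import Data.Fin.Properties as Fin
open import Data.List using (List; []; _∷_; cartesianProductWith; filter)
open import Data.List.Extrema.Nat using (argmin; argmin-all; f[argmin]≤f[xs])
open import Data.List.Membership.Propositional using (_∈_)
open import Data.List.Membership.Propositional.Properties using (∈-cartesianProductWith⁺; ∈-filter⁺)
import Data.List.Relation.Unary.All as All
open import Data.List.Relation.Unary.All.Properties using (all-filter)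
open import Data.List.Relation.Unary.Any using (here; there)
open import Data.Nat using (zero; suc; _+_; _≟_)
open import Data.Product using (_,_; proj₁)
open import Data.Sum using (inj₁; inj₂)
open import Data.Vec using (Vec; []; _∷_; lookup; tabulate)
open import Data.Vec.Properties using (lookup∘tabulate)
open import Function using (_∘_; mk⇔; Equivalence)
open import Relation.Binary.Construct.Closure.ReflexiveTransitive using (ε; _◅_; _◅◅_)
open import Relation.Binary.PropositionalEquality
  using (_≢_; _≗_; refl; sym; trans; cong; cong₂; subst₂; module ≡-Reasoning)
open import Relation.Nullary using (Dec; yes; no; contradiction)
open import Relation.Nullary.Decidable using (_×-dec_; _→-dec_)
open import Relation.Unary using (Decidable)

private variable
  k m n : ℕ

sumFin-cong : {f g : Fin k → ℕ} → f ≗ g → sumFin f ≡ sumFin g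
sumFin-cong {zero}  f≗g = refl
sumFin-cong {suc k} f≗g = cong₂ _+_ (f≗g zero) (sumFin-cong (f≗g ∘ suc))

count-cong : {f g : Fin k → Bool} → f ≗ g → count f ≡ count g
count-cong {zero}  f≗g = refl
count-cong {suc k} f≗g =
  cong₂ _+_ (cong (λ b → if b then 1 else 0) (f≗g zero)) (count-cong (f≗g ∘ suc))

none⇒count≡0 : {f : Fin k → Bool} → (∀ i → f i ≡ false) → count f ≡ 0
none⇒count≡0 {zero}  none = refl
none⇒count≡0 {suc k} {f} none with f zero | none zero
... | false | refl = none⇒count≡0 (none ∘ suc)

count≡0⇒none : {f : Fin k → Bool} → count f ≡ 0 → ∀ i → f i ≡ false
count≡0⇒none {suc k} {f} count≡0 zero with f zero
count≡0⇒none {suc k} {f} ()      zero | true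
count≡0⇒none {suc k} {f} count≡0 zero | false = refl
count≡0⇒none {suc k} count≡0 (suc i) = count≡0⇒none (m+n≡0⇒n≡0 _ count≡0) i

sumFin-update : (f g : Fin k → ℕ) (x : Fin k) → (∀ i → i ≢ x → f i ≡ g i) →
                sumFin f + g x ≡ sumFin g + f x
sumFin-update {suc k} f g zero f≡g =
  trans (cong (λ s → f zero + s + g zero) (sumFin-cong λ i → f≡g (suc i) λ ()))
        (xy∙z≈zy∙x (f zero) (sumFin (g ∘ suc)) (g zero))
sumFin-update {suc k} f g (suc x) f≡g = begin
  f zero + sumFin (f ∘ suc) + g (suc x)    ≡⟨ +-assoc (f zero) _ _ ⟩
  f zero + (sumFin (f ∘ suc) + g (suc x))  ≡⟨ cong₂ _+_ (f≡g zero λ ()) tail-update ⟩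
  g zero + (sumFin (g ∘ suc) + f (suc x))  ≡⟨ +-assoc (g zero) _ _ ⟨
  g zero + sumFin (g ∘ suc) + f (suc x)    ∎
  where
  open ≡-Reasoning
  tail-update : sumFin (f ∘ suc) + g (suc x) ≡ sumFin (g ∘ suc) + f (suc x)
  tail-update = sumFin-update (f ∘ suc) (g ∘ suc) x λ i i≢x → f≡g (suc i) (i≢x ∘ Fin.suc-injective)

sumFin≡sum : (f : Fin k → ℕ) → sumFin f ≡ sum f
sumFin≡sum {zero}  f = refl
sumFin≡sum {suc k} f = cong (f zero +_) (sumFin≡sum (f ∘ suc))

count≡sum : (f : Fin k → Bool) → count f ≡ sum (λ i → if f i then 1 else 0)
count≡sum {zero}  f = refl
count≡sum {suc k} f = cong ((if f zero then 1 else 0) +_) (count≡sum (f ∘ suc))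

edges : BipGraph m n → ℕ
edges B = sumFin (count ∘ B)

_ᵀ : BipGraph m n → BipGraph n m
(B ᵀ) y x = B x y

_≗₂_ : BipGraph m n → BipGraph m n → Set
B ≗₂ B′ = ∀ x → B x ≗ B′ x

edges≡∑∑ : (B : BipGraph m n) →
           edges B ≡ sum (λ x → sum (λ y → if B x y then 1 else 0))
edges≡∑∑ B = trans (sumFin≡sum (count ∘ B)) (sum-cong-≗ (count≡sum ∘ B))

edges-ᵀ : (B : BipGraph m n) → edges (B ᵀ) ≡ edges B
edges-ᵀ B = trans (edges≡∑∑ (B ᵀ))
                  (trans (sym (∑-comm λ x y → if B x y then 1 else 0)) (sym (edges≡∑∑ B)))

cost-ᵀ : (G B : BipGraph m n) → cost (G ᵀ) (B ᵀ) ≡ cost G B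
cost-ᵀ G B = edges-ᵀ (symDiff G B)

edges-cong : {B B′ : BipGraph m n} → B ≗₂ B′ → edges B ≡ edges B′
edges-cong B≗B′ = sumFin-cong (count-cong ∘ B≗B′)

cost-cong : (G : BipGraph m n) {B B′ : BipGraph m n} → B ≗₂ B′ → cost G B ≡ cost G B′
cost-cong G B≗B′ = edges-cong λ x y → cong (G x y xor_) (B≗B′ x y)

P₄Free : BipGraph m n → Set
P₄Free B = ∀ x y x′ y′ → B x y ≡ true → B x′ y ≡ true → B x′ y′ ≡ true → B x y′ ≡ true

P₄Free? : (B : BipGraph m n) → Dec (P₄Free B)
P₄Free? B = Fin.all? λ x → Fin.all? λ y → Fin.all? λ x′ → Fin.all? λ y′ →
  (B x y Bool.≟ true) →-dec (B x′ y Bool.≟ true) →-dec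
  (B x′ y′ Bool.≟ true) →-dec (B x y′ Bool.≟ true)

P₄Free-cong : {B B′ : BipGraph m n} → B ≗₂ B′ → P₄Free B → P₄Free B′
P₄Free-cong B≗B′ free x y x′ y′ xy x′y x′y′ = trans (sym (B≗B′ x y′))
  (free x y x′ y′ (trans (B≗B′ x y) xy) (trans (B≗B′ x′ y) x′y) (trans (B≗B′ x′ y′) x′y′))

P₄Free-ᵀ : {B : BipGraph m n} → P₄Free B → P₄Free (B ᵀ)
P₄Free-ᵀ free y x y′ x′ yx y′x y′x′ = free x′ y′ x y y′x′ y′x yx

edgeless : BipGraph m n
edgeless _ _ = false

P₄Free-edgeless : P₄Free (edgeless {m} {n})
P₄Free-edgeless _ _ _ _ ()

-- Connectivity in a P₄-free graph collapses to this relation.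
Near : BipGraph m n → Vertex m n → Vertex m n → Set
Near B (inj₁ x) (inj₁ x′) = ∀ y → B x y ≡ true → B x′ y ≡ true
Near B (inj₁ x) (inj₂ y)  = B x y ≡ true
Near B (inj₂ y) (inj₁ x)  = B x y ≡ true
Near B (inj₂ y) (inj₂ y′) = ∀ x → B x y ≡ true → B x y′ ≡ true

connected⇒near : {B : BipGraph m n} → P₄Free B → ∀ {u w} → Connected B u w → Near B u w
connected⇒near free {inj₁ x} ε = λ _ xy → xy
connected⇒near free {inj₂ y} ε = λ _ xy → xy
connected⇒near free {inj₁ x} {inj₁ x′} (left xy ◅ path) =
  λ y′ xy′ → free x′ _ x y′ (connected⇒near free path) xy xy′
connected⇒near free {inj₁ x} {inj₂ y′} (left xy ◅ path) = connected⇒near free path x xy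
connected⇒near free {inj₂ y} {inj₁ x′} (right xy ◅ path) = connected⇒near free path y xy
connected⇒near free {inj₂ y} {inj₂ y′} (right xy ◅ path) =
  λ x′ x′y → free x′ y _ y′ x′y xy (connected⇒near free path)

near-adjacent : {B : BipGraph m n} → ∀ v {x y} →
                Near B v (inj₁ x) → Near B v (inj₂ y) → B x y ≡ true
near-adjacent (inj₁ x₀) {y = y} N[x₀]⊆N[x] x₀y = N[x₀]⊆N[x] y x₀y
near-adjacent (inj₂ y₀) {x = x} xy₀ N[y₀]⊆N[y] = N[y₀]⊆N[y] x xy₀

P₄Free⇒IsBiclustering : {B : BipGraph m n} → P₄Free B → IsBiclustering B
P₄Free⇒IsBiclustering {B = B} free v =
  (λ x v~x y → mk⇔ (λ xy → v~x ◅◅ left xy ◅ ε) (λ v~y → adjacent v~x v~y)) ,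
  (λ y v~y x → mk⇔ (λ xy → v~y ◅◅ right xy ◅ ε) (λ v~x → adjacent v~x v~y))
  where
  adjacent : ∀ {x y} → Connected B v (inj₁ x) → Connected B v (inj₂ y) → B x y ≡ true
  adjacent v~x v~y = near-adjacent v (connected⇒near free v~x) (connected⇒near free v~y)

IsBiclustering⇒P₄Free : {B : BipGraph m n} → IsBiclustering B → P₄Free B
IsBiclustering⇒P₄Free bic x y x′ y′ xy x′y x′y′ =
  Equivalence.from (proj₁ (bic (inj₁ x)) x ε y′) (left xy ◅ right x′y ◅ left x′y′ ◅ ε)

vectors : {A : Set} → List A → ∀ k → List (Vec A k)
vectors xs zero    = [] ∷ []
vectors xs (suc k) = cartesianProductWith _∷_ xs (vectors xs k)

∈-vectors : {A : Set} {xs : List A} → (∀ a → a ∈ xs) → (v : Vec A k) → v ∈ vectors xs k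
∈-vectors ∈xs []      = here refl
∈-vectors ∈xs (a ∷ v) = ∈-cartesianProductWith⁺ _∷_ (∈xs a) (∈-vectors ∈xs v)

matrices : ∀ m n → List (Vec (Vec Bool n) m)
matrices m n = vectors (vectors (true ∷ false ∷ []) n) m

∈-matrices : (M : Vec (Vec Bool n) m) → M ∈ matrices m n
∈-matrices = ∈-vectors (∈-vectors λ { true → here refl ; false → there (here refl) })

graphOf : Vec (Vec Bool n) m → BipGraph m n
graphOf M x y = lookup (lookup M x) y

matrixOf : BipGraph m n → Vec (Vec Bool n) m
matrixOf B = tabulate (tabulate ∘ B)

graphOf-matrixOf : (B : BipGraph m n) → graphOf (matrixOf B) ≗₂ B
graphOf-matrixOf B x y =
  trans (cong (λ row → lookup row y) (lookup∘tabulate _ x)) (lookup∘tabulate (B x) y)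

-- Graphs are functions, which cannot be enumerated up to ≡, so the search runs over matrices.
minimiser : {Q : BipGraph m n → Set} → Decidable Q → (∀ {B B′} → B ≗₂ B′ → Q B → Q B′) →
            (f : BipGraph m n → ℕ) → (∀ {B B′} → B ≗₂ B′ → f B ≡ f B′) →
            ∀ {B₀} → Q B₀ → Σ (BipGraph m n) λ B → Q B × (∀ B′ → Q B′ → f B ≤ f B′)
minimiser {m} {n} {Q} Q? Q-cong f f-cong {B₀} QB₀ =
  graphOf M ,
  argmin-all (f ∘ graphOf) (viaMatrix QB₀) (all-filter (Q? ∘ graphOf) (matrices m n)) ,
  minimal
  where
  candidates : List (Vec (Vec Bool n) m)
  candidates = filter (Q? ∘ graphOf) (matrices m n)
  M : Vec (Vec Bool n) m
  M = argmin (f ∘ graphOf) (matrixOf B₀) candidates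
  viaMatrix : ∀ {B} → Q B → Q (graphOf (matrixOf B))
  viaMatrix {B} = Q-cong λ x y → sym (graphOf-matrixOf B x y)
  minimal : ∀ B′ → Q B′ → f (graphOf M) ≤ f B′
  minimal B′ QB′ = ≤-trans
    (All.lookup (f[argmin]≤f[xs] {f = f ∘ graphOf} (matrixOf B₀) candidates)
                (∈-filter⁺ (Q? ∘ graphOf) (∈-matrices (matrixOf B′)) (viaMatrix QB′)))
    (≤-reflexive (f-cong (graphOf-matrixOf B′)))

record FewestEdgesOptimum (G B : BipGraph m n) : Set where
  field
    p₄Free      : P₄Free B
    optimal     : ∀ B′ → P₄Free B′ → cost G B ≤ cost G B′
    fewestEdges : ∀ B′ → P₄Free B′ → cost G B′ ≡ cost G B → edges B ≤ edges B′

fewestEdgesOptimum : (G : BipGraph m n) → Σ (BipGraph m n) (FewestEdgesOptimum G)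
fewestEdgesOptimum G =
  let B₁ , free₁ , optimal₁ = minimiser P₄Free? P₄Free-cong (cost G) (cost-cong G) P₄Free-edgeless
      B , (free , cost≡) , fewest = minimiser (λ B → P₄Free? B ×-dec (cost G B ≟ cost G B₁))
        (λ B≗B′ (free , cost≡) → P₄Free-cong B≗B′ free , trans (sym (cost-cong G B≗B′)) cost≡)
        edges edges-cong (free₁ , refl)
  in B , record
    { p₄Free      = free
    ; optimal     = λ B′ free′ → ≤-trans (≤-reflexive cost≡) (optimal₁ B′ free′)
    ; fewestEdges = λ B′ free′ cost′≡ → fewest B′ (free′ , trans cost′≡ cost≡)
    }

FewestEdgesOptimum-ᵀ : {G B : BipGraph m n} →
                       FewestEdgesOptimum G B → FewestEdgesOptimum (G ᵀ) (B ᵀ)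
FewestEdgesOptimum-ᵀ {G = G} {B} opt = record
  { p₄Free      = P₄Free-ᵀ p₄Free
  ; optimal     = λ B′ free′ →
      subst₂ _≤_ (sym (cost-ᵀ G B)) (cost-ᵀ (G ᵀ) B′) (optimal (B′ ᵀ) (P₄Free-ᵀ free′))
  ; fewestEdges = λ B′ free′ cost′≡ →
      subst₂ _≤_ (sym (edges-ᵀ B)) (edges-ᵀ B′)
        (fewestEdges (B′ ᵀ) (P₄Free-ᵀ free′) (trans (cost-ᵀ (G ᵀ) B′) (trans cost′≡ (cost-ᵀ G B))))
  }
  where open FewestEdgesOptimum opt

isolate : BipGraph m n → Fin m → BipGraph m n
isolate B x x′ y with x′ Fin.≟ x
... | yes _ = false
... | no  _ = B x′ y

isolate-self : (B : BipGraph m n) (x : Fin m) → ∀ y → isolate B x x y ≡ false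
isolate-self B x y with x Fin.≟ x
... | yes _   = refl
... | no  x≢x = contradiction refl x≢x

isolate-other : (B : BipGraph m n) {x x′ : Fin m} → x′ ≢ x → ∀ y → isolate B x x′ y ≡ B x′ y
isolate-other B {x} {x′} x′≢x y with x′ Fin.≟ x
... | yes x′≡x = contradiction x′≡x x′≢x
... | no  _    = refl

isolate-edge : (B : BipGraph m n) (x : Fin m) → ∀ {x′ y} →
               isolate B x x′ y ≡ true → x′ ≢ x × B x′ y ≡ true
isolate-edge B x {x′} e with x′ Fin.≟ x
... | no x′≢x = x′≢x , e

P₄Free-isolate : {B : BipGraph m n} (x : Fin m) → P₄Free B → P₄Free (isolate B x)
P₄Free-isolate {B = B} x free x₁ y x₂ y′ x₁y x₂y x₂y′
  with isolate-edge B x x₁y | isolate-edge B x x₂y | isolate-edge B x x₂y′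
... | x₁≢x , B-x₁y | _ , B-x₂y | _ , B-x₂y′ =
  trans (isolate-other B x₁≢x y′) (free x₁ y x₂ y′ B-x₁y B-x₂y B-x₂y′)

cost-isolate : (G B : BipGraph m n) (x : Fin m) →
               cost G B + deg G (inj₁ x) ≡ cost G (isolate B x) + diffDeg G B (inj₁ x)
cost-isolate G B x = trans (cong (cost G B +_) (sym isolated-row)) (sumFin-update _ _ x other-rows)
  where
  isolated-row : count (symDiff G (isolate B x) x) ≡ deg G (inj₁ x)
  isolated-row =
    count-cong λ y → trans (cong (G x y xor_) (isolate-self B x y)) (xor-identityʳ (G x y))
  other-rows : ∀ x′ → x′ ≢ x → count (symDiff G B x′) ≡ count (symDiff G (isolate B x) x′)
  other-rows x′ x′≢x = count-cong λ y → cong (G x′ y xor_) (sym (isolate-other B x′≢x y))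

edges-isolate : (B : BipGraph m n) (x : Fin m) → edges B ≡ edges (isolate B x) + count (B x)
edges-isolate B x = begin
  edges B                                ≡⟨ +-identityʳ _ ⟨
  edges B + 0                            ≡⟨ cong (edges B +_) (none⇒count≡0 (isolate-self B x)) ⟨
  edges B + count (isolate B x x)        ≡⟨ sumFin-update _ _ x other-rows ⟩
  edges (isolate B x) + count (B x)      ∎
  where
  open ≡-Reasoning
  other-rows : ∀ x′ → x′ ≢ x → count (B x′) ≡ count (isolate B x x′)
  other-rows x′ x′≢x = count-cong λ y → sym (isolate-other B x′≢x y)

deletion : ∀ {g b} → b ≡ false → g xor b ≡ true → g ≡ true × b ≡ false
deletion {true} refl _ = refl , refl

EditBound : BipGraph m n → BipGraph m n → Vertex m n → Set
EditBound G B v = (diffDeg G B v ≡ deg G v × AllDeletionsAt G B v) ⊎ diffDeg G B v < deg G v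

editBound-row : {G B : BipGraph m n} → FewestEdgesOptimum G B → (x : Fin m) → EditBound G B (inj₁ x)
editBound-row {m = m} {n = n} {G = G} {B} opt x = classify (m≤n⇒m<n∨m≡n edits≤deg)
  where
  open FewestEdgesOptimum opt
  B′ : BipGraph m n
  B′ = isolate B x
  free′ : P₄Free B′
  free′ = P₄Free-isolate x p₄Free
  edits≤deg : diffDeg G B (inj₁ x) ≤ deg G (inj₁ x)
  edits≤deg = +-cancelˡ-≤ (cost G B′) _ _
    (≤-trans (≤-reflexive (sym (cost-isolate G B x))) (+-monoˡ-≤ _ (optimal B′ free′)))
  row-empty : diffDeg G B (inj₁ x) ≡ deg G (inj₁ x) → ∀ y → B x y ≡ false
  row-empty edits≡deg = count≡0⇒none (n≤0⇒n≡0 (+-cancelˡ-≤ (edges B′) _ 0 (begin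
    edges B′ + count (B x)  ≡⟨ edges-isolate B x ⟨
    edges B                 ≤⟨ fewestEdges B′ free′ same-cost ⟩
    edges B′                ≡⟨ +-identityʳ _ ⟨
    edges B′ + 0            ∎)))
    where
    open ≤-Reasoning
    same-cost : cost G B′ ≡ cost G B
    same-cost = sym (+-cancelʳ-≡ _ _ _ (trans (cost-isolate G B x) (cong (cost G B′ +_) edits≡deg)))
  classify : diffDeg G B (inj₁ x) < deg G (inj₁ x) ⊎ diffDeg G B (inj₁ x) ≡ deg G (inj₁ x) →
             EditBound G B (inj₁ x)
  classify (inj₁ edits<deg) = inj₂ edits<deg
  classify (inj₂ edits≡deg) = inj₁ (edits≡deg , λ y → deletion (row-empty edits≡deg y))

lemma6 : (m n : ℕ) (G : BipGraph m n) →
    Σ (BipGraph m n) λ B →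
      IsOptimalBiclustering G B ×
      ((v : Vertex m n) →
        (diffDeg G B v ≡ deg G v × AllDeletionsAt G B v) ⊎ diffDeg G B v < deg G v)
lemma6 m n G =
  let B , opt = fewestEdgesOptimum G
      open FewestEdgesOptimum opt
  in B ,
     (P₄Free⇒IsBiclustering p₄Free , λ B′ bic′ → optimal B′ (IsBiclustering⇒P₄Free bic′)) ,
     λ where
       (inj₁ x) → editBound-row opt x
       (inj₂ y) → editBound-row (FewestEdgesOptimum-ᵀ opt) y
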